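{- Let $\mathcal H\subseteq 2^V$ be a hypergraph satisfying: (A0) $\mathcal H$ is transversal-free; (B1) for every long position $x\in\mathbb Z_{\ge0}^V$ and every integer $z$ with $m(x)\le z<h_{\mathcal H}(x)$ there is a move $x\to x'$ such that $x'$ is long and $h_{\mathcal H}(x')=z$; (C2) for every position $x\in\mathbb Z_{\ge0}^V$ and every integer $1\le\eta<y_{\mathcal H}(x)$ there is a move $x\to x'$ with $m(x')=m(x)$ and $y_{\mathcal H}(x')=\eta$; (C3) for every position $x\in\mathbb Z_{\ge0}^V$ and all integers $\mu,\eta$ with $0\le\mu<m(x)$ and $m(x)-\mu+1\le\eta\le y_{\mathcal H}(x)$ there is a move $x\to x'$ with $m(x')=\mu$ and $y_{\mathcal H}(x')=\eta$. Then $\mathcal H$ is JM.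
   Context: Let $V=\{1,\dots,n\}$. A hypergraph is a family $\mathcal H\subseteq 2^V$ with $\mathcal H\neq\emptyset$, $\emptyset\notin\mathcal H$, $V=\bigcup_{H\in\mathcal H}H$. The game $NIM_{\mathcal H}$ is played on positions $x\in\mathbb{Z}_{\ge 0}^V$; a move ($H$-move) $x\to x'$ chooses $H\in\mathcal H$ and goes to any $x'\in\mathbb Z_{\ge0}^V$ with $x'_i<x_i$ for $i\in H$ and $x'_i=x_i$ for $i\notin H$. Players alternate; the player who cannot move loses. The Sprague–Grundy function is $\mathcal G_{\mathcal H}(x)=\mathrm{mex}\{\mathcal G_{\mathcal H}(x') : x\to x' \text{ a move}\}$ ($\mathrm{mex}(S)$ = least nonnegative integer not in $S$). The height $h_{\mathcal H}(x)$ is the maximum number of consecutive moves possible from $x$. With $e$ the all-ones vector, $m(x)=\min_{i}x_i$, $y_{\mathcal H}(x)=h_{\mathcal H}(x-m(x)e)+1$, $v_{\mathcal H}(x)=\binom{y_{\mathcal H}(x)}{2}+\big((m(x)-\binom{y_{\mathcal H}(x)}{2}-1)\bmod y_{\mathcal H}(x)\big)$ (residue in $\{0,\dots,y_{\mathcal H}(x)-1\}$). A position $x$ is long if $m(x)\le\binom{y_{\mathcal H}(x)}{2}$ and short otherwise; $f_{\mathcal H}(x)=h_{\mathcal H}(x)$ if $x$ is long and $f_{\mathcal H}(x)=v_{\mathcal H}(x)$ if $x$ is short. $\mathcal H$ is JM if $\mathcal G_{\mathcal H}=f_{\mathcal H}$ on $\mathbb Z_{\ge0}^V$. $\mathcal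 H$ is transversal-free if for every $H\in\mathcal H$ there is $H'\in\mathcal H$ with $H\cap H'=\emptyset$. -}

module Defs where

open import Data.Nat using (ℕ; zero; suc; _+_; _∸_; _≤_; _<_; _≤?_; _<?_; _≟_; _⊓_; _⊔_)
open import Data.Nat.DivMod using (_%_)
open import Data.Nat.Combinatorics using (_C_)
open import Data.Fin using (Fin)
open import Data.Fin.Subset using (Subset; _∈_; _∉_; _∩_; Nonempty; Empty)
open import Data.Fin.Subset.Properties using (_∈?_)
open import Data.Fin.Properties using (all?)
open import Data.Vec using (Vec; []; _∷_; lookup; foldr; map)
open import Data.List using (List; []; _∷_; filter; concatMap; upTo; length)
import Data.List as L
open import Data.List.Relation.Unary.Any using (Any; any?)
open import Data.List.Membership.DecPropositional _≟_ using ()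
  renaming (_∈?_ to _∈ℕ?_)
open import Data.List.Membership.Propositional using () renaming (_∈_ to _∈L_)
open import Data.Product using (_×_; ∃; Σ-syntax)
open import Data.Bool using (if_then_else_)
open import Relation.Nullary using (Dec; yes; no; ¬_; ¬?; does)
open import Relation.Nullary.Decidable using (_×-dec_; _→-dec_)
open import Relation.Binary.PropositionalEquality using (_≡_)

Pos : ℕ → Set
Pos n = Vec ℕ n

Family : ℕ → Set
Family n = List (Subset n)

record IsHypergraph {n : ℕ} (ℋ : Family n) : Set where
  field
    nonempty : ¬ (ℋ ≡ [])
    noEmptyEdge : ∀ H → H ∈L ℋ → Nonempty H
    covers : ∀ (i : Fin n) → Any (λ H → i ∈ H) ℋ

TransversalFree : ∀ {n} → Family n → Set
TransversalFree ℋ = ∀ H → H ∈L ℋ →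
                     Any (λ H' → Empty (H ∩ H')) ℋ

HMove : ∀ {n} → Subset n → Pos n → Pos n → Set
HMove H x x' = ∀ i → (i ∈ H → lookup x' i < lookup x i)
                   × (i ∉ H → lookup x' i ≡ lookup x i)

Move : ∀ {n} → Family n → Pos n → Pos n → Set
Move ℋ x x' = Any (λ H → HMove H x x') ℋ

HMove? : ∀ {n} (H : Subset n) x x' → Dec (HMove H x x')
HMove? H x x' = all? (λ i → ((i ∈? H) →-dec (lookup x' i <? lookup x i))
                         ×-dec (¬? (i ∈? H) →-dec (lookup x' i ≟ lookup x i)))

Move? : ∀ {n} (ℋ : Family n) x x' → Dec (Move ℋ x x')
Move? ℋ x x' = any? (λ H → HMove? H x x') ℋ

below : ∀ {n} → Pos n → List (Pos n)
below [] = [] ∷ []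
below (a ∷ v) = concatMap (λ k → L.map (k ∷_) (below v)) (upTo (suc a))

moves : ∀ {n} → Family n → Pos n → List (Pos n)
moves ℋ x = filter (Move? ℋ x) (below x)

mexFrom : ℕ → ℕ → List ℕ → ℕ
mexFrom zero k l = k
mexFrom (suc f) k l = if does (k ∈ℕ? l) then mexFrom f (suc k) l else k

mex : List ℕ → ℕ
mex l = mexFrom (suc (length l)) 0 l

sumV : ∀ {n} → Pos n → ℕ
sumV = foldr _ _+_ 0

-- fuel-indexed recursions; every move strictly decreases sumV, so fuel sumV x suffices
grundyF : ∀ {n} → Family n → ℕ → Pos n → ℕ
grundyF ℋ zero x = mex []
grundyF ℋ (suc k) x = mex (L.map (grundyF ℋ k) (moves ℋ x))

grundy : ∀ {n} → Family n → Pos n → ℕ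
grundy ℋ x = grundyF ℋ (sumV x) x

heightF : ∀ {n} → Family n → ℕ → Pos n → ℕ
heightF ℋ zero x = 0
heightF ℋ (suc k) x = L.foldr _⊔_ 0 (L.map (λ x' → suc (heightF ℋ k x')) (moves ℋ x))

height : ∀ {n} → Family n → Pos n → ℕ
height ℋ x = heightF ℋ (sumV x) x

-- m(x) = min_i x_i   (for n = 0 this is 0; irrelevant since no hypergraph exists then)
minV : ∀ {n} → Pos n → ℕ
minV [] = 0
minV (a ∷ []) = a
minV (a ∷ v@(_ ∷ _)) = a ⊓ minV v

yH : ∀ {n} → Family n → Pos n → ℕ
yH ℋ x = suc (height ℋ (map (_∸ minV x) x))

-- v(x) = C(y,2) + ((m - C(y,2) - 1) mod y); only used for short x, where m - C(y,2) - 1 ≥ 0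
vH : ∀ {n} → Family n → Pos n → ℕ
vH ℋ x = (y C 2) + ((minV x ∸ (y C 2) ∸ 1) % suc h)
  where
    h = height ℋ (map (_∸ minV x) x)
    y = suc h

Long : ∀ {n} → Family n → Pos n → Set
Long ℋ x = minV x ≤ (yH ℋ x C 2)

Short : ∀ {n} → Family n → Pos n → Set
Short ℋ x = ¬ Long ℋ x

fH : ∀ {n} → Family n → Pos n → ℕ
fH ℋ x = if does (minV x ≤? (yH ℋ x C 2)) then height ℋ x else vH ℋ x

IsJM : ∀ {n} → Family n → Set
IsJM ℋ = ∀ x → grundy ℋ x ≡ fH ℋ x

CondB1 : ∀ {n} → Family n → Set
CondB1 ℋ = ∀ x → Long ℋ x → ∀ z → minV x ≤ z → z < height ℋ x →
           ∃ λ x' → Move ℋ x x' × Long ℋ x' × height ℋ x' ≡ z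

CondC2 : ∀ {n} → Family n → Set
CondC2 ℋ = ∀ x η → 1 ≤ η → η < yH ℋ x →
           ∃ λ x' → Move ℋ x x' × minV x' ≡ minV x × yH ℋ x' ≡ η

-- note: μ < m(x) so m(x) - μ + 1 is computed exactly in ℕ
CondC3 : ∀ {n} → Family n → Set
CondC3 ℋ = ∀ x μ η → μ < minV x → minV x ∸ μ + 1 ≤ η → η ≤ yH ℋ x →
           ∃ λ x' → Move ℋ x x' × minV x' ≡ μ × yH ℋ x' ≡ η

-- Writing T y = y(y-1)/2, the candidate function f is the height h(x) at long
-- positions and, at short ones, the value v(y, m) = T y + ((m - T y - 1) mod y)
-- determined by y = y(x) and m = m(x); note T y ≤ v < T y + y.  Since the
-- Sprague–Grundy function is the mex over the moves, G = f follows by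
-- induction on the total size Σ x_i once we know, for every position x:
--   (P1) no move x → x' has f(x') = f(x), and
--   (P2) every j < f(x) equals f(x') for some move x → x'.
-- P1 uses transversal-freeness: a move leaves some edge untouched, whence
-- h(x') ≥ m(x) and y(x') > m(x) - m(x'); together with the block structure of
-- the values v and distinctness of residues this rules out f(x') = f(x).
-- P2 uses (B1) for m(x) ≤ j < h(x); for j < m(x) in block y' (T y' ≤ j <
-- T y' + y') we target a short x' with y(x') = y' and m(x') ≡ j + 1 mod y',
-- reached by (C2) if m(x') = m(x) and by (C3) otherwise.
module Submission where

open import Defs
open import Data.Nat
open import Data.Nat.Properties
open import Data.Nat.DivMod
open import Data.Nat.Divisibility using (_∣_; divides; ∣⇒≤)
open import Data.Nat.Combinatorics using (_C_; nCk+nC[k+1]≡[n+1]C[k+1]; nC1≡n)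
open import Data.Fin as F using (toℕ)
open import Data.Fin.Properties using (pigeonhole; toℕ<n)
open import Data.Fin.Subset using (Subset; _∈_; Nonempty)
open import Data.Fin.Subset.Properties using (_∈?_; x∈p∩q⁺)
open import Data.Vec as V using ([]; _∷_; lookup; tabulate)
open import Data.Vec.Properties using (lookup∘tabulate; lookup-map)
open import Data.List as L using (List; []; _∷_; length)
open import Data.List.Properties using (map-cong-local; filter-none)
open import Data.List.Membership.Propositional using (lose; find) renaming (_∈_ to _∈L_; _∉_ to _∉L_)
open import Data.List.Membership.Propositional.Properties
  using (∈-map⁺; ∈-map⁻; ∈-filter⁺; ∈-filter⁻; ∈-concatMap⁺; ∈-upTo⁺)
open import Data.List.Membership.DecPropositional _≟_ using () renaming (_∈?_ to _∈ℕ?_)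
import Data.List.Relation.Unary.All as All
open import Data.List.Relation.Unary.Any as Any using (here; there)
open import Data.List.Relation.Unary.Any.Properties using (lookup-index)
open import Data.Product using (_×_; _,_; proj₁; proj₂; ∃)
open import Data.Sum using (inj₁; inj₂; _⊎_)
open import Data.Empty using (⊥; ⊥-elim)
open import Data.Bool using (if_then_else_)
open import Function using (_∘_)
open import Relation.Binary.Definitions using (tri<; tri≈; tri>)
open import Relation.Nullary using (yes; no; does)
open import Relation.Nullary.Decidable using (dec-true; dec-false)
open import Relation.Binary.PropositionalEquality

-- Triangular numbers and their blocks

tri : ℕ → ℕ
tri y = y C 2

tri-suc : ∀ y → tri (suc y) ≡ tri y + y
tri-suc y = begin
  tri (suc y)     ≡⟨ sym (nCk+nC[k+1]≡[n+1]C[k+1] y 1) ⟩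
  y C 1 + tri y   ≡⟨ cong (_+ tri y) (nC1≡n y) ⟩
  y + tri y       ≡⟨ +-comm y (tri y) ⟩
  tri y + y       ∎
  where open ≡-Reasoning

tri-block-≤ : ∀ {a b} → a < b → tri a + a ≤ tri b
tri-block-≤ {a} {suc b} (s≤s a≤b) with m≤n⇒m<n∨m≡n a≤b
... | inj₂ refl = ≤-reflexive (sym (tri-suc a))
... | inj₁ a<b  = ≤-trans (tri-block-≤ a<b)
                    (≤-trans (m≤m+n (tri b) b) (≤-reflexive (sym (tri-suc b))))

tri-mono : ∀ {a b} → a ≤ b → tri a ≤ tri b
tri-mono a≤b with m≤n⇒m<n∨m≡n a≤b
... | inj₂ refl = ≤-refl
... | inj₁ a<b  = ≤-trans (m≤m+n _ _) (tri-block-≤ a<b)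

InBlock : ℕ → ℕ → Set
InBlock y j = tri y ≤ j × j < tri y + y

block : ∀ j → ∃ λ η → InBlock (suc η) j
block zero = 0 , z≤n , s≤s z≤n
block (suc j) with block j
... | η , lo , hi with suc j <? tri (suc η) + suc η
...   | yes inside = η , m≤n⇒m≤1+n lo , inside
...   | no outside = suc η , ≤-reflexive start ,
          subst (λ t → suc j < t + suc (suc η)) (sym start) (m<m+n (suc j) z<s)
  where
    start : tri (suc (suc η)) ≡ suc j
    start = trans (tri-suc (suc η)) (≤-antisym (≮⇒≥ outside) hi)

block-unique : ∀ {j y y'} → InBlock y j → InBlock y' j → y ≡ y'
block-unique {y = y} {y'} (lo , hi) (lo' , hi') with <-cmp y y'
... | tri≈ _ y≡y' _ = y≡y'
... | tri< y<y' _ _ = ⊥-elim (<⇒≱ hi (≤-trans (tri-block-≤ y<y') lo'))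
... | tri> _ _ y'<y = ⊥-elim (<⇒≱ hi' (≤-trans (tri-block-≤ y'<y) lo))

block-< : ∀ {η j y} → InBlock η j → j < tri y → η < y
block-< {η} {y = y} (lo , _) j<Ty with η <? y
... | yes η<y = η<y
... | no η≮y  = ⊥-elim (<⇒≱ j<Ty (≤-trans (tri-mono (≮⇒≥ η≮y)) lo))

%-≡⇒∣∸ : ∀ a b y .{{_ : NonZero y}} → a % y ≡ b % y → y ∣ b ∸ a
%-≡⇒∣∸ a b y eq = divides (b / y ∸ a / y) (begin
  b ∸ a                                     ≡⟨ cong₂ _∸_ (m≡m%n+[m/n]*n b y) (m≡m%n+[m/n]*n a y) ⟩
  (b % y + b / y * y) ∸ (a % y + a / y * y) ≡⟨ cong (λ r → (b % y + b / y * y) ∸ (r + a / y * y)) eq ⟩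
  (b % y + b / y * y) ∸ (b % y + a / y * y) ≡⟨ [m+n]∸[m+o]≡n∸o (b % y) _ _ ⟩
  b / y * y ∸ a / y * y                     ≡⟨ sym (*-distribʳ-∸ y (b / y) (a / y)) ⟩
  (b / y ∸ a / y) * y                       ∎)
  where open ≡-Reasoning

%-shift-≢ : ∀ a d y .{{_ : NonZero y}} → 0 < d → d < y → (a + d) % y ≢ a % y
%-shift-≢ a d y 0<d d<y eq = <⇒≱ d<y (∣⇒≤ {{>-nonZero 0<d}} y∣d)
  where
    y∣d : y ∣ d
    y∣d = subst (y ∣_) (m+n∸m≡n a d) (%-≡⇒∣∸ a (a + d) y (sym eq))

-- Lowering m > j by ((m - j - 1) mod y) gives μ with j < μ ≤ m, m - μ < y
-- and μ ≡ j + 1 (mod y).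
align : ∀ m j y .{{_ : NonZero y}} → j < m →
        ∃ λ μ → j < μ × μ ≤ m × m ∸ μ < y × y ∣ μ ∸ suc j
align m j y j<m = m ∸ d , j<μ , m∸n≤m m d , gap , y∣
  where
    A = m ∸ suc j
    d = A % y
    d≤m : d ≤ m
    d≤m = ≤-trans (m%n≤m A y) (m∸n≤m m (suc j))
    j<μ : j < m ∸ d
    j<μ = ≤-trans (≤-reflexive (sym (m∸[m∸n]≡n j<m))) (∸-monoʳ-≤ m (m%n≤m A y))
    gap : m ∸ (m ∸ d) < y
    gap = subst (_< y) (sym (m∸[m∸n]≡n d≤m)) (m%n<n A y)
    y∣ : y ∣ (m ∸ d) ∸ suc j
    y∣ = divides (A / y) (begin
      (m ∸ d) ∸ suc j       ≡⟨ ∸-+-assoc m d (suc j) ⟩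
      m ∸ (d + suc j)       ≡⟨ cong (m ∸_) (+-comm d (suc j)) ⟩
      m ∸ (suc j + d)       ≡⟨ sym (∸-+-assoc m (suc j) d) ⟩
      A ∸ d                 ≡⟨ cong (_∸ d) (m≡m%n+[m/n]*n A y) ⟩
      (d + A / y * y) ∸ d   ≡⟨ m+n∸m≡n d _ ⟩
      A / y * y             ∎)
      where open ≡-Reasoning

-- The value of a short position

shortValue : (y m : ℕ) .{{_ : NonZero y}} → ℕ
shortValue y m = tri y + ((m ∸ tri y ∸ 1) % y)

shortValue-cong : ∀ {y y' m m'} .{{_ : NonZero y}} .{{_ : NonZero y'}} →
                  y ≡ y' → m ≡ m' → shortValue y m ≡ shortValue y' m'
shortValue-cong refl refl = refl

∸-∸1 : ∀ a b → a ∸ b ∸ 1 ≡ a ∸ suc b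
∸-∸1 a b = trans (∸-+-assoc a b 1) (cong (a ∸_) (+-comm b 1))

shortValue-inBlock : ∀ y m .{{_ : NonZero y}} → InBlock y (shortValue y m)
shortValue-inBlock y m = m≤m+n (tri y) _ , +-monoʳ-< (tri y) (m%n<n (m ∸ tri y ∸ 1) y)

shortValue-determines-y : ∀ {y y' m m'} .{{_ : NonZero y}} .{{_ : NonZero y'}} →
                          shortValue y m ≡ shortValue y' m' → y ≡ y'
shortValue-determines-y {y} {y'} {m} {m'} same =
  block-unique (subst (InBlock y) same (shortValue-inBlock y m)) (shortValue-inBlock y' m')

shortValue-< : ∀ y m .{{_ : NonZero y}} → tri y < m → shortValue y m < m
shortValue-< y m Ty<m = begin-strict
  tri y + ((m ∸ tri y ∸ 1) % y)  ≤⟨ +-monoʳ-≤ (tri y) (m%n≤m _ y) ⟩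
  tri y + (m ∸ tri y ∸ 1)        ≡⟨ cong (tri y +_) (∸-∸1 m (tri y)) ⟩
  tri y + (m ∸ suc (tri y))      <⟨ ≤-reflexive (m+[n∸m]≡n Ty<m) ⟩
  m                              ∎
  where open ≤-Reasoning

shortValue-injective : ∀ y {m' m} .{{_ : NonZero y}} → tri y < m' → m' < m → m ∸ m' < y →
                       shortValue y m' ≢ shortValue y m
shortValue-injective y {m'} {m} Ty<m' m'<m gap eq =
  %-shift-≢ k (m ∸ m') y (m<n⇒0<n∸m m'<m) gap residues
  where
    open ≡-Reasoning
    k = m' ∸ tri y ∸ 1
    split : m ∸ tri y ∸ 1 ≡ k + (m ∸ m')
    split = begin
      m ∸ tri y ∸ 1                   ≡⟨ ∸-∸1 m (tri y) ⟩
      m ∸ suc (tri y)                 ≡⟨ cong (_∸ suc (tri y)) (sym (m+[n∸m]≡n (<⇒≤ m'<m))) ⟩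
      (m' + (m ∸ m')) ∸ suc (tri y)   ≡⟨ +-∸-comm (m ∸ m') Ty<m' ⟩
      (m' ∸ suc (tri y)) + (m ∸ m')   ≡⟨ cong (_+ (m ∸ m')) (sym (∸-∸1 m' (tri y))) ⟩
      k + (m ∸ m')                    ∎
    residues : (k + (m ∸ m')) % y ≡ k % y
    residues = trans (cong (_% y) (sym split)) (sym (+-cancelˡ-≡ (tri y) _ _ eq))

shortValue-hit : ∀ y {j μ} .{{_ : NonZero y}} → InBlock y j → j < μ → y ∣ μ ∸ suc j →
                 shortValue y μ ≡ j
shortValue-hit y {j} {μ} (lo , hi) j<μ y∣ = begin
  tri y + ((μ ∸ tri y ∸ 1) % y)      ≡⟨ cong (λ t → tri y + (t % y)) split ⟩
  tri y + ((u + (μ ∸ suc j)) % y)    ≡⟨ cong (tri y +_) (%-remove-+ʳ u y∣) ⟩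
  tri y + (u % y)                    ≡⟨ cong (tri y +_) (m<n⇒m%n≡m u<y) ⟩
  tri y + u                          ≡⟨ m+[n∸m]≡n lo ⟩
  j                                  ∎
  where
    open ≡-Reasoning
    u = j ∸ tri y
    u<y : u < y
    u<y = +-cancelˡ-< (tri y) u y (subst (_< tri y + y) (sym (m+[n∸m]≡n lo)) hi)
    split : μ ∸ tri y ∸ 1 ≡ u + (μ ∸ suc j)
    split = begin
      μ ∸ tri y ∸ 1                         ≡⟨ ∸-∸1 μ (tri y) ⟩
      μ ∸ suc (tri y)                       ≡⟨ cong (_∸ suc (tri y)) (sym (m+[n∸m]≡n j<μ)) ⟩
      (suc j + (μ ∸ suc j)) ∸ suc (tri y)   ≡⟨ +-∸-comm (μ ∸ suc j) (s≤s lo) ⟩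
      u + (μ ∸ suc j)                       ∎

-- The minimal excluded value

mexFrom-spec : ∀ f s l k → s ≤ k → k ≤ s + f → k ∉L l → (∀ j → s ≤ j → j < k → j ∈L l) →
               mexFrom f s l ≡ k
mexFrom-spec zero s l k s≤k k≤s+0 _ _ = ≤-antisym s≤k (subst (k ≤_) (+-identityʳ s) k≤s+0)
mexFrom-spec (suc f) s l k s≤k k≤ k∉ below with s ∈ℕ? l | m≤n⇒m<n∨m≡n s≤k
... | no s∉  | inj₁ s<k  = ⊥-elim (s∉ (below s ≤-refl s<k))
... | no _   | inj₂ s≡k  = s≡k
... | yes s∈ | inj₂ refl = ⊥-elim (k∉ s∈)
... | yes _  | inj₁ s<k  =
  mexFrom-spec f (suc s) l k s<k (subst (k ≤_) (+-suc s f) k≤) k∉ (λ j s<j → below j (<⇒≤ s<j))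

length-≥ : ∀ k (l : List ℕ) → (∀ j → j < k → j ∈L l) → k ≤ length l
length-≥ k l below with k ≤? length l
... | yes k≤ = k≤
... | no k≰ with pigeonhole (≰⇒> k≰) (λ i → Any.index (below (toℕ i) (toℕ<n i)))
...   | i , j , i<j , same = ⊥-elim (<⇒≢ i<j (begin
  toℕ i                                               ≡⟨ lookup-index (below (toℕ i) (toℕ<n i)) ⟩
  L.lookup l (Any.index (below (toℕ i) (toℕ<n i)))    ≡⟨ cong (L.lookup l) same ⟩
  L.lookup l (Any.index (below (toℕ j) (toℕ<n j)))    ≡⟨ sym (lookup-index (below (toℕ j) (toℕ<n j))) ⟩
  toℕ j                                               ∎))
  where open ≡-Reasoning

mex-char : ∀ l k → k ∉L l → (∀ j → j < k → j ∈L l) → mex l ≡ k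
mex-char l k k∉ below =
  mexFrom-spec (suc (length l)) 0 l k z≤n (m≤n⇒m≤1+n (length-≥ k l below)) k∉ (λ j _ → below j)

_≤ᵥ_ : ∀ {n} → Pos n → Pos n → Set
x' ≤ᵥ x = ∀ i → lookup x' i ≤ lookup x i

sumV-mono : ∀ {n} (x' x : Pos n) → x' ≤ᵥ x → sumV x' ≤ sumV x
sumV-mono []        []      _ = z≤n
sumV-mono (a' ∷ x') (a ∷ x) p = +-mono-≤ (p F.zero) (sumV-mono x' x (p ∘ F.suc))

sumV-strict : ∀ {n} (x' x : Pos n) → x' ≤ᵥ x → ∀ i → lookup x' i < lookup x i → sumV x' < sumV x
sumV-strict (a' ∷ x') (a ∷ x) p F.zero    lt = +-mono-<-≤ lt (sumV-mono x' x (p ∘ F.suc))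
sumV-strict (a' ∷ x') (a ∷ x) p (F.suc i) lt = +-mono-≤-< (p F.zero) (sumV-strict x' x (p ∘ F.suc) i lt)

minV-≤ : ∀ {n} (x : Pos n) i → minV x ≤ lookup x i
minV-≤ (a ∷ [])    F.zero    = ≤-refl
minV-≤ (a ∷ b ∷ x) F.zero    = m⊓n≤m a _
minV-≤ (a ∷ b ∷ x) (F.suc i) = ≤-trans (m⊓n≤n a _) (minV-≤ (b ∷ x) i)

minV-mono : ∀ {n} (x' x : Pos n) → x' ≤ᵥ x → minV x' ≤ minV x
minV-mono []             []           _ = z≤n
minV-mono (a' ∷ [])      (a ∷ [])     p = p F.zero
minV-mono (a' ∷ b' ∷ x') (a ∷ b ∷ x) p = ⊓-mono-≤ (p F.zero) (minV-mono (b' ∷ x') (b ∷ x) (p ∘ F.suc))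

below-complete : ∀ {n} (x x' : Pos n) → x' ≤ᵥ x → x' ∈L below x
below-complete []      []       _ = here refl
below-complete (a ∷ x) (b ∷ x') p =
  ∈-concatMap⁺ (λ k → L.map (k ∷_) (below x)) (lose {P = λ k → (b ∷ x') ∈L L.map (k ∷_) (below x)}
                     (∈-upTo⁺ (s≤s (p F.zero)))
                     (∈-map⁺ (b ∷_) (below-complete x x' (p ∘ F.suc))))

pred-bounds : ∀ {c a} → suc c ≤ a → c ≤ pred a × pred a < a
pred-bounds (s≤s c≤a) = c≤a , ≤-refl

foldr-⊔-≥ : ∀ {a} (l : List ℕ) → a ∈L l → a ≤ L.foldr _⊔_ 0 l
foldr-⊔-≥ (b ∷ l) (here refl) = m≤m⊔n b _
foldr-⊔-≥ (b ∷ l) (there a∈) = ≤-trans (foldr-⊔-≥ l a∈) (m≤n⊔m b _)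

-- The game NIM_ℋ, for any family of nonempty edges

module Game {n : ℕ} (ℋ : Family n) (edgesNonempty : ∀ H → H ∈L ℋ → Nonempty H) where

  hmove-≤ : ∀ (H : Subset n) (x x' : Pos n) → HMove H x x' → x' ≤ᵥ x
  hmove-≤ H x x' hm i with i ∈? H
  ... | yes i∈ = <⇒≤ (proj₁ (hm i) i∈)
  ... | no i∉  = ≤-reflexive (proj₂ (hm i) i∉)

  move-≤ : ∀ x x' → Move ℋ x x' → x' ≤ᵥ x
  move-≤ x x' mv with find mv
  ... | H , _ , hm = hmove-≤ H x x' hm

  move-decreases-sum : ∀ x x' → Move ℋ x x' → sumV x' < sumV x
  move-decreases-sum x x' mv with find mv
  ... | H , H∈ , hm with edgesNonempty H H∈
  ... | i , i∈ = sumV-strict x' x (hmove-≤ H x x' hm) i (proj₁ (hm i) i∈)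

  moves-sound : ∀ x x' → x' ∈L moves ℋ x → Move ℋ x x'
  moves-sound x x' m = proj₂ (∈-filter⁻ (Move? ℋ x) {xs = below x} m)

  moves-complete : ∀ x x' → Move ℋ x x' → x' ∈L moves ℋ x
  moves-complete x x' mv = ∈-filter⁺ (Move? ℋ x) (below-complete x x' (move-≤ x x' mv)) mv

  moves-empty : ∀ x → sumV x ≡ 0 → moves ℋ x ≡ []
  moves-empty x s≡0 = filter-none (Move? ℋ x)
    (All.universal (λ x' mv → n≮0 (subst (sumV x' <_) s≡0 (move-decreases-sum x x' mv))) (below x))

  -- A recursion along moves, F (k+1) x = Φ (F k) x, where Φ g x only inspects
  -- g at the moves of x, does not depend on the fuel k once k ≥ Σ x.
  module Unfold (Φ : (Pos n → ℕ) → Pos n → ℕ)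
                (Φ-local : ∀ {g g'} x → (∀ x' → Move ℋ x x' → g x' ≡ g' x') → Φ g x ≡ Φ g' x)
                (F : ℕ → Pos n → ℕ)
                (F-zero : ∀ x g → moves ℋ x ≡ [] → F zero x ≡ Φ g x)
                (F-suc : ∀ k x → F (suc k) x ≡ Φ (F k) x) where

    fuel-irrelevant : ∀ k k' x → sumV x ≤ k → sumV x ≤ k' → F k x ≡ F k' x
    fuel-irrelevant zero    zero     x _ _ = refl
    fuel-irrelevant zero    (suc k') x p _ =
      trans (F-zero x (F k') (moves-empty x (n≤0⇒n≡0 p))) (sym (F-suc k' x))
    fuel-irrelevant (suc k) zero     x _ q =
      trans (F-suc k x) (sym (F-zero x (F k) (moves-empty x (n≤0⇒n≡0 q))))
    fuel-irrelevant (suc k) (suc k') x p q = trans (F-suc k x) (trans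
      (Φ-local x (λ x' mv → let lt = move-decreases-sum x x' mv in
        fuel-irrelevant k k' x' (≤-pred (≤-trans lt p)) (≤-pred (≤-trans lt q))))
      (sym (F-suc k' x)))

    unfold : ∀ x → F (sumV x) x ≡ Φ (λ x' → F (sumV x') x') x
    unfold x = trans (fuel-irrelevant (sumV x) (suc (sumV x)) x ≤-refl (n≤1+n _))
      (trans (F-suc (sumV x) x) (Φ-local x (λ x' mv →
        fuel-irrelevant (sumV x) (sumV x') x' (<⇒≤ (move-decreases-sum x x' mv)) ≤-refl)))

  map-moves-local : ∀ {g g' : Pos n → ℕ} x → (∀ x' → Move ℋ x x' → g x' ≡ g' x') →
                    L.map g (moves ℋ x) ≡ L.map g' (moves ℋ x)
  map-moves-local x same = map-cong-local (All.tabulate (λ {x'} m → same x' (moves-sound x x' m)))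

  grundy-unfold : ∀ x → grundy ℋ x ≡ mex (L.map (grundy ℋ) (moves ℋ x))
  grundy-unfold = Unfold.unfold (λ g x → mex (L.map g (moves ℋ x)))
    (λ x same → cong mex (map-moves-local x same)) (grundyF ℋ)
    (λ x g none → cong (λ l → mex (L.map g l)) (sym none)) (λ _ _ → refl)

  height-unfold : ∀ x → height ℋ x ≡ L.foldr _⊔_ 0 (L.map (λ x' → suc (height ℋ x')) (moves ℋ x))
  height-unfold = Unfold.unfold (λ g x → L.foldr _⊔_ 0 (L.map (suc ∘ g) (moves ℋ x)))
    (λ x same → cong (L.foldr _⊔_ 0) (map-moves-local x (λ x' mv → cong suc (same x' mv))))
    (heightF ℋ) (λ x g none → cong (λ l → L.foldr _⊔_ 0 (L.map (suc ∘ g) l)) (sym none))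
    (λ _ _ → refl)

  height-decreases : ∀ x x' → Move ℋ x x' → height ℋ x' < height ℋ x
  height-decreases x x' mv = subst (height ℋ x' <_) (sym (height-unfold x))
    (foldr-⊔-≥ (L.map (λ z → suc (height ℋ z)) (moves ℋ x)) (∈-map⁺ _ (moves-complete x x' mv)))

  lowerOn : Subset n → Pos n → Pos n
  lowerOn H x = tabulate (λ i → if does (i ∈? H) then pred (lookup x i) else lookup x i)

  -- If every coordinate of an edge H is at least c, then c H-moves in a row are possible.
  height-≥ : ∀ c x H → H ∈L ℋ → (∀ i → i ∈ H → c ≤ lookup x i) → c ≤ height ℋ x
  height-≥ zero    x H H∈ _  = z≤n
  height-≥ (suc c) x H H∈ c< =
    ≤-trans (s≤s (height-≥ c (lowerOn H x) H H∈ still)) (height-decreases x (lowerOn H x) (lose H∈ lowering))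
    where
      entry : ∀ i → lookup (lowerOn H x) i ≡ (if does (i ∈? H) then pred (lookup x i) else lookup x i)
      entry i = lookup∘tabulate _ i
      still : ∀ i → i ∈ H → c ≤ lookup (lowerOn H x) i
      still i i∈ rewrite entry i with i ∈? H
      ... | yes _  = proj₁ (pred-bounds (c< i i∈))
      ... | no i∉  = ⊥-elim (i∉ i∈)
      lowering : HMove H x (lowerOn H x)
      lowering i rewrite entry i with i ∈? H
      ... | yes i∈ = (λ _ → proj₂ (pred-bounds (c< i i∈))) , (λ i∉ → ⊥-elim (i∉ i∈))
      ... | no i∉  = (λ i∈ → ⊥-elim (i∉ i∈)) , (λ _ → refl)

  move-shift : ∀ x x' c → (∀ i → c ≤ lookup x' i) → Move ℋ x x' →
               Move ℋ (V.map (_∸ c) x) (V.map (_∸ c) x')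
  move-shift x x' c c≤ = Any.map shifted
    where
      shifted : ∀ {H} → HMove H x x' → HMove H (V.map (_∸ c) x) (V.map (_∸ c) x')
      shifted hm i rewrite lookup-map i (_∸ c) x | lookup-map i (_∸ c) x' =
        (λ i∈ → ∸-monoˡ-< (proj₁ (hm i) i∈) (c≤ i)) , (λ i∉ → cong (_∸ c) (proj₂ (hm i) i∉))

  -- A move that keeps the minimum lowers y: it is also a move between the
  -- normalised positions x - m e and x' - m e.
  y-decreases : ∀ x x' → Move ℋ x x' → minV x' ≡ minV x → yH ℋ x' < yH ℋ x
  y-decreases x x' mv same = s≤s (subst (λ c → height ℋ (V.map (_∸ c) x') < height ℋ (V.map (_∸ m) x))
    (sym same) (height-decreases (V.map (_∸ m) x) (V.map (_∸ m) x') (move-shift x x' m above mv)))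
    where
      m = minV x
      above : ∀ i → m ≤ lookup x' i
      above i = subst (_≤ lookup x' i) same (minV-≤ x' i)

-- Consequences of transversal-freeness

module TransversalFreeGame {n : ℕ} (ℋ : Family n) (edgesNonempty : ∀ H → H ∈L ℋ → Nonempty H)
                           (tf : TransversalFree ℋ) where
  open Game ℋ edgesNonempty

  untouched-edge : ∀ x x' → Move ℋ x x' →
                   ∃ λ H' → H' ∈L ℋ × (∀ i → i ∈ H' → lookup x' i ≡ lookup x i)
  untouched-edge x x' mv with find mv
  ... | H , H∈ , hm with find (tf H H∈)
  ... | H' , H'∈ , disjoint =
    H' , H'∈ , λ i i∈H' → proj₂ (hm i) (λ i∈H → disjoint (i , x∈p∩q⁺ (i∈H , i∈H')))

  min-≤-height : ∀ x x' → Move ℋ x x' → minV x ≤ height ℋ x'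
  min-≤-height x x' mv with untouched-edge x x' mv
  ... | H' , H'∈ , kept =
    height-≥ (minV x) x' H' H'∈ (λ i i∈ → subst (minV x ≤_) (sym (kept i i∈)) (minV-≤ x i))

  -- Likewise for x' - m(x') e, whose untouched coordinates are ≥ m(x) - m(x').
  min-drop-< : ∀ x x' → Move ℋ x x' → minV x ∸ minV x' < yH ℋ x'
  min-drop-< x x' mv with untouched-edge x x' mv
  ... | H' , H'∈ , kept = s≤s (height-≥ (minV x ∸ minV x') (V.map (_∸ minV x') x') H' H'∈ bound)
    where
      bound : ∀ i → i ∈ H' → minV x ∸ minV x' ≤ lookup (V.map (_∸ minV x') x') i
      bound i i∈ = subst (minV x ∸ minV x' ≤_)
        (sym (trans (lookup-map i (_∸ minV x') x') (cong (_∸ minV x') (kept i i∈))))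
        (∸-monoˡ-≤ (minV x') (minV-≤ x i))

-- The JM property

module JM {n : ℕ} (ℋ : Family n) (hyp : IsHypergraph ℋ) (tf : TransversalFree ℋ)
          (b1 : CondB1 ℋ) (c2 : CondC2 ℋ) (c3 : CondC3 ℋ) where
  open IsHypergraph hyp using (noEmptyEdge)
  open Game ℋ noEmptyEdge
  open TransversalFreeGame ℋ noEmptyEdge tf

  fH-long : ∀ x → Long ℋ x → fH ℋ x ≡ height ℋ x
  fH-long x l = cong (if_then height ℋ x else vH ℋ x) (dec-true (minV x ≤? tri (yH ℋ x)) l)

  fH-short : ∀ x → Short ℋ x → fH ℋ x ≡ shortValue (yH ℋ x) (minV x)
  fH-short x s = cong (if_then height ℋ x else vH ℋ x) (dec-false (minV x ≤? tri (yH ℋ x)) s)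

  short-< : ∀ x → Short ℋ x → shortValue (yH ℋ x) (minV x) < minV x
  short-< x s = shortValue-< (yH ℋ x) (minV x) (≰⇒> s)

  -- Two short positions related by a move have different values: equal values
  -- force equal y, which a move keeping the minimum cannot have, while a move
  -- lowering the minimum by less than y changes the residue.
  short-moves-differ : ∀ x x' → Move ℋ x x' → Short ℋ x → Short ℋ x' →
                       shortValue (yH ℋ x') (minV x') ≢ shortValue (yH ℋ x) (minV x)
  short-moves-differ x x' mv s s' same = byMinimum (m≤n⇒m<n∨m≡n (minV-mono x' x (move-≤ x x' mv)))
    where
      sameY : yH ℋ x' ≡ yH ℋ x
      sameY = shortValue-determines-y same
      byMinimum : minV x' < minV x ⊎ minV x' ≡ minV x → ⊥
      byMinimum (inj₂ sameMin) = <⇒≢ (y-decreases x x' mv sameMin) sameY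
      byMinimum (inj₁ lower) =
        shortValue-injective (yH ℋ x) (subst (λ y → tri y < minV x') sameY (≰⇒> s'))
          lower (subst (minV x ∸ minV x' <_) sameY (min-drop-< x x' mv))
          (trans (shortValue-cong (sym sameY) refl) same)

  -- Two long positions differ in height; when
  -- exactly one side is short its value lies below its minimum, hence below
  -- the heights bounded by min-≤-height; two short positions are handled by
  -- short-moves-differ.
  f-changes : ∀ x x' → Move ℋ x x' → fH ℋ x' ≢ fH ℋ x
  f-changes x x' mv eq with minV x ≤? tri (yH ℋ x) | minV x' ≤? tri (yH ℋ x')
  ... | yes l | yes l' = <⇒≢ (height-decreases x x' mv) (trans (sym (fH-long x' l')) (trans eq (fH-long x l)))
  ... | yes l | no s' = <⇒≢ v'<h (trans (sym (fH-short x' s')) (trans eq (fH-long x l)))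
    where
      v'<h : shortValue (yH ℋ x') (minV x') < height ℋ x
      v'<h = begin-strict
        shortValue (yH ℋ x') (minV x')  <⟨ short-< x' s' ⟩
        minV x'                         ≤⟨ minV-mono x' x (move-≤ x x' mv) ⟩
        minV x                          ≤⟨ min-≤-height x x' mv ⟩
        height ℋ x'                     <⟨ height-decreases x x' mv ⟩
        height ℋ x                      ∎
        where open ≤-Reasoning
  ... | no s | yes l' = <⇒≢ (<-≤-trans (short-< x s) (min-≤-height x x' mv))
          (trans (sym (fH-short x s)) (trans (sym eq) (fH-long x' l')))
  ... | no s | no s' = short-moves-differ x x' mv s s' (trans (sym (fH-short x' s')) (trans eq (fH-short x s)))

  short-target : ∀ x' {j μ η} → InBlock (suc η) j → j < μ → suc η ∣ μ ∸ suc j →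
                 minV x' ≡ μ → yH ℋ x' ≡ suc η → fH ℋ x' ≡ j
  short-target x' {η = η} blk j<μ y∣ refl refl =
    trans (fH-short x' short) (shortValue-hit (suc η) blk j<μ y∣)
    where
      short : Short ℋ x'
      short long = <⇒≱ j<μ (≤-trans long (proj₁ blk))

  -- A j < m(x) in a block η + 1 ≤ y(x) is reached by (C2) or (C3), unless the
  -- target would have the same m and y as x itself.
  reach-below-min : ∀ x j η → j < minV x → InBlock (suc η) j → suc η ≤ yH ℋ x →
                    (suc η ≡ yH ℋ x → j ≢ shortValue (yH ℋ x) (minV x)) →
                    ∃ λ x' → Move ℋ x x' × fH ℋ x' ≡ j
  reach-below-min x j η j<m blk η≤y notSelf with align (minV x) j (suc η) j<m
  ... | μ , j<μ , μ≤m , gap , y∣ with m≤n⇒m<n∨m≡n μ≤m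
  ...   | inj₁ μ<m =
          let x' , mv , em , ey = c3 x μ (suc η) μ<m (subst (_≤ suc η) (+-comm 1 _) gap) η≤y
          in x' , mv , short-target x' blk j<μ y∣ em ey
  ...   | inj₂ μ≡m =
          let x' , mv , em , ey = c2 x (suc η) (s≤s z≤n) η<y
          in x' , mv , short-target x' blk j<μ y∣ (trans em (sym μ≡m)) ey
    where
      η<y : suc η < yH ℋ x
      η<y with m≤n⇒m<n∨m≡n η≤y
      ... | inj₁ η<y = η<y
      ... | inj₂ η≡y = ⊥-elim (notSelf η≡y (sym (trans (shortValue-cong (sym η≡y) (sym μ≡m))
                                                      (shortValue-hit (suc η) blk j<μ y∣))))

  -- (P2) Every smaller value is attained by a move: by (B1) when x is long and
  -- m(x) ≤ j; otherwise j < m(x) and the block of j is at most y(x), strictly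
  -- below it when x is long (j < m(x) ≤ T y(x)), and j < v(x) when x is short.
  f-reaches : ∀ x j → j < fH ℋ x → ∃ λ x' → Move ℋ x x' × fH ℋ x' ≡ j
  f-reaches x j j<f with minV x ≤? tri (yH ℋ x)
  ... | no s with block j
  ...   | η , blk = reach-below-min x j η j<m blk (≤-pred (block-< blk j<Ty+1)) (λ _ → <⇒≢ j<v)
    where
      j<v : j < shortValue (yH ℋ x) (minV x)
      j<v = subst (j <_) (fH-short x s) j<f
      j<m : j < minV x
      j<m = <-trans j<v (short-< x s)
      j<Ty+1 : j < tri (suc (yH ℋ x))
      j<Ty+1 = subst (j <_) (sym (tri-suc (yH ℋ x)))
                 (<-trans j<v (proj₂ (shortValue-inBlock (yH ℋ x) (minV x))))
  f-reaches x j j<f | yes l with minV x ≤? j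
  ... | yes m≤j with b1 x l j m≤j (subst (j <_) (fH-long x l) j<f)
  ...   | x' , mv , l' , hj = x' , mv , trans (fH-long x' l') hj
  f-reaches x j j<f | yes l | no m≰j with block j
  ...   | η , blk = reach-below-min x j η (≰⇒> m≰j) blk (<⇒≤ η<y) (λ η≡y → ⊥-elim (<⇒≢ η<y η≡y))
    where
      η<y : suc η < yH ℋ x
      η<y = block-< blk (<-≤-trans (≰⇒> m≰j) l)

  grundy≡f-step : ∀ x → (∀ x' → Move ℋ x x' → grundy ℋ x' ≡ fH ℋ x') → grundy ℋ x ≡ fH ℋ x
  grundy≡f-step x ih = trans (grundy-unfold x) (mex-char _ (fH ℋ x) excluded present)
    where
      excluded : fH ℋ x ∉L L.map (grundy ℋ) (moves ℋ x)
      excluded f∈ with ∈-map⁻ (grundy ℋ) f∈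
      ... | x' , x'∈ , eq = let mv = moves-sound x x' x'∈ in
        f-changes x x' mv (trans (sym (ih x' mv)) (sym eq))
      present : ∀ j → j < fH ℋ x → j ∈L L.map (grundy ℋ) (moves ℋ x)
      present j j<f with f-reaches x j j<f
      ... | x' , mv , fx'≡j = subst (_∈L L.map (grundy ℋ) (moves ℋ x)) (trans (ih x' mv) fx'≡j)
                                (∈-map⁺ (grundy ℋ) (moves-complete x x' mv))

  grundy≡f : ∀ s x → sumV x < s → grundy ℋ x ≡ fH ℋ x
  grundy≡f (suc s) x (s≤s bound) =
    grundy≡f-step x (λ x' mv → grundy≡f s x' (<-≤-trans (move-decreases-sum x x' mv) bound))

corollary4p3 : {n : ℕ} (ℋ : Family n) → IsHypergraph ℋ → TransversalFree ℋ →
    CondB1 ℋ → CondC2 ℋ → CondC3 ℋ → IsJM ℋ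
corollary4p3 ℋ hyp tf b1 c2 c3 x = JM.grundy≡f ℋ hyp tf b1 c2 c3 (suc (sumV x)) x ≤-refl
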